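{- Let $M=(E,G)\in\mathcal E_3$ and let $H$ be a hyperplane of $G$ such that $M|H$ is not a Bose–Burton geometry. Then $M$ is a semidoubling of $M|H$.
   Context: A simple binary matroid (here just "matroid") is a pair $M=(E,G)$, where $G$ is identified with $\mathbb F_2^n\setminus\{0\}$ and $E\subseteq G$. A flat of $G$ is a set $V\setminus\{0\}$ with $V$ a subspace, of dimension $\dim V$; a hyperplane is a flat of dimension $n-1$; $M|H=(E\cap H,H)$. $\mathcal E_3$ is the class of matroids $(E,G)$ with $|E\cap F|$ even for every flat $F$ of dimension at least $3$. A Bose–Burton geometry (of order $k$) is a matroid $(G\setminus F,G)$ where $F$ is a flat of $G$ of codimension $k$ (i.e. $\dim F=\dim G-k$). $M$ is a semidoubling of $M|H$ if there are $w\in G\setminus(H\cup E)$ and a hyperplane $H_0$ of $H$ with $E=(E\cap H)\cup\{w+x:x\in(E\cap H)\triangle(H\setminus H_0)\}$. -}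

module Defs where

open import Data.Bool using (Bool; true; false; _∧_; _∨_; not; _xor_; if_then_else_)
open import Data.Nat using (ℕ; zero; suc; _≤_)
open import Data.Nat.Divisibility using (_∣_)
open import Data.Vec using (Vec; []; _∷_; replicate; zipWith)
open import Data.List using (List; []; _∷_; _++_; map)
open import Data.Product using (Σ; _×_; ∃)
open import Data.Sum using (_⊎_)
open import Relation.Binary.PropositionalEquality using (_≡_)
open import Relation.Nullary using (¬_)
open import Function.Bundles using (_⇔_)

-- Points of F_2^n : Boolean vectors (true = 1), addition = coordinatewise xor.
Vector : ℕ → Set
Vector n = Vec Bool n

0v : ∀ {n} → Vector n
0v = replicate _ false

infixl 6 _⊕_
_⊕_ : ∀ {n} → Vector n → Vector n → Vector n
_⊕_ = zipWith _xor_

_==b_ : Bool → Bool → Bool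
true ==b b = b
false ==b b = not b

_==v_ : ∀ {n} → Vector n → Vector n → Bool
[] ==v [] = true
(a ∷ u) ==v (b ∷ v) = (a ==b b) ∧ (u ==v v)

isZero : ∀ {n} → Vector n → Bool
isZero v = v ==v 0v

allVecs : (n : ℕ) → List (Vector n)
allVecs zero = [] ∷ []
allVecs (suc n) = map (false ∷_) (allVecs n) ++ map (true ∷_) (allVecs n)

anyL : ∀ {A : Set} → (A → Bool) → List A → Bool
anyL p [] = false
anyL p (x ∷ xs) = p x ∨ anyL p xs

countL : ∀ {A : Set} → (A → Bool) → List A → ℕ
countL p [] = zero
countL p (x ∷ xs) = if p x then suc (countL p xs) else countL p xs

count : ∀ {n} → (Vector n → Bool) → ℕ
count {n} P = countL P (allVecs n)

comb : ∀ {n d} → Vec Bool d → Vec (Vector n) d → Vector n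
comb [] [] = 0v
comb (c ∷ cs) (b ∷ bs) = (if c then b else 0v) ⊕ comb cs bs

LinIndep : ∀ {n d} → Vec (Vector n) d → Set
LinIndep {n} {d} b = (c : Vec Bool d) → comb c b ≡ 0v → c ≡ 0v

inSpan : ∀ {n d} → Vec (Vector n) d → Vector n → Bool
inSpan {n} {d} b x = anyL (λ c → comb c b ==v x) (allVecs d)

-- A flat of G = F_2^n \ {0} of dimension d is span(b) \ {0} for a
-- linearly independent family b of d vectors; membership in that flat:
inFlat : ∀ {n d} → Vec (Vector n) d → Vector n → Bool
inFlat b x = inSpan b x ∧ not (isZero x)

-- A matroid (E, G) with G = F_2^n \ {0}: E given by its characteristic
-- function, with E ⊆ G expressed by E 0 = false.
IsMatroid : ∀ {n} → (Vector n → Bool) → Set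
IsMatroid E = E 0v ≡ false

InE3 : ∀ {n} → (Vector n → Bool) → Set
InE3 {n} E = (d : ℕ) → 3 ≤ d → (b : Vec (Vector n) d) → LinIndep b →
  2 ∣ count (λ x → E x ∧ inFlat b x)

_⊆F_ : ∀ {n d e} → Vec (Vector n) d → Vec (Vector n) e → Set
f ⊆F h = ∀ x → inFlat f x ≡ true → inFlat h x ≡ true

-- M|H = (E ∩ H, H), H = flat with basis h of dimension m (so H ≅ F_2^m \ {0}).
-- It is a Bose–Burton geometry iff E ∩ H = H \ F for a flat F of H of
-- codimension k (0 ≤ k ≤ m), i.e. of dimension d ≤ m.
RestrIsBoseBurton : ∀ {n m} → (Vector n → Bool) → Vec (Vector n) m → Set
RestrIsBoseBurton {n} {m} E h =
  Σ ℕ λ d → d ≤ m × Σ (Vec (Vector n) d) λ f → LinIndep f × f ⊆F h ×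
    (∀ x → (E x ∧ inFlat h x) ≡ (inFlat h x ∧ not (inFlat f x)))

-- M = (E,G) is a semidoubling of M|H (H with basis h, of dimension m):
-- there are w ∈ G \ (H ∪ E) and a hyperplane H0 of H with
-- E = (E ∩ H) ∪ { w + x : x ∈ (E ∩ H) △ (H \ H0) }.
IsSemidoubling : ∀ {n m} → (Vector n → Bool) → Vec (Vector n) m → Set
IsSemidoubling {n} {m} E h =
  Σ (Vector n) λ w → isZero w ≡ false × inFlat h w ≡ false × E w ≡ false ×
  Σ ℕ λ d → suc d ≡ m × Σ (Vec (Vector n) d) λ h0 → LinIndep h0 × h0 ⊆F h ×
  (∀ y → (E y ≡ true) ⇔
     ((E y ∧ inFlat h y) ≡ true ⊎
      Σ (Vector n) λ x →
        ((E x ∧ inFlat h x) xor (inFlat h x ∧ not (inFlat h0 x))) ≡ true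
        × y ≡ w ⊕ x))

-- For w outside the hyperplane H put Δ_w(x) = E(w + x) + E(x) on H.  Parity on the 3-flat
-- spanned by w and two points a, b of H gives Δ_w(a + b) = Δ_w(a) + Δ_w(b) + E(w), so for
-- w ∉ H ∪ E the map Δ_w is a linear functional on H.  If one of these functionals is nonzero,
-- its kernel is a hyperplane H₀ of H and E(w + x) = E(x) + [x ∉ H₀] for x ∈ H: this is the
-- semidoubling.  Otherwise E(w + x) = E(x) for all w ∉ H ∪ E and x ∈ H, and then H \ E
-- together with 0 is closed under addition (by shifting along such a w if there is one, and
-- by the parity identity with E(w) = 1 if every point off H lies in E), so M|H is a
-- Bose–Burton geometry.

module Submission where

open import Defs
open import Data.Bool using (Bool; true; false; _∧_; not; _xor_; if_then_else_)
import Data.Bool.Properties as Bool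
open import Data.Bool.Properties using (xor-assoc; xor-comm; xor-same; xor-∧-commutativeRing)
open import Data.Nat using (ℕ; zero; suc; _≤_; _<_; _+_; _*_; _^_; z≤n; s≤s)
open import Data.Nat.Properties
  using ( ≤-trans; ≤-antisym; ≤-reflexive; <⇒≱; ≰⇒>; ^-monoʳ-<; +-identityʳ; +-suc; n≮n; n<1+n; _≤?_
        ; module ≤-Reasoning)
open import Data.Nat.Divisibility using (_∣_; divides)
open import Data.Vec using (Vec; []; _∷_)
open import Data.Vec.Properties as Vec using (zipWith-assoc; zipWith-comm; zipWith-identityˡ; zipWith-identityʳ)
open import Data.Vec.Relation.Unary.All using ([]; _∷_) renaming (All to VecAll)
open import Data.List using (List; []; _∷_; _++_; map; length; filter; deduplicate; foldr)
open import Data.List.Properties using (length-map; length-++; length-filter; length-deduplicate)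
open import Data.List.Membership.Propositional using (_∈_; lose)
open import Data.List.Membership.Propositional.Properties
  using (∈-map⁺; ∈-map⁻; ∈-++⁺ˡ; ∈-++⁺ʳ; ∈-filter⁺; ∈-filter⁻; ∈-deduplicate⁺)
open import Data.List.Membership.Propositional.Properties.WithK using (unique∧set⇒bag)
import Data.List.Membership.DecPropositional as DecMembership
open import Data.List.Relation.Binary.Subset.Propositional using (_⊆_)
open import Data.List.Relation.Binary.BagAndSetEquality using (∼bag⇒↭)
open import Data.List.Relation.Binary.Permutation.Propositional.Properties using (↭-length)
open import Data.List.Relation.Unary.All using ([])
open import Data.List.Relation.Unary.Any using (here; there; any?; satisfied)
open import Data.List.Relation.Unary.Unique.Propositional using (Unique; []; _∷_)
import Data.List.Relation.Unary.Unique.Propositional.Properties as Unique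
open import Data.List.Relation.Unary.Unique.DecPropositional.Properties using (deduplicate-!)
open import Data.Product using (_×_; ∃; _,_; proj₁; proj₂)
open import Data.Sum using (_⊎_; inj₁; inj₂)
open import Function using (_∘_; _⇔_; mk⇔; case_of_)
open import Relation.Binary.Definitions using (DecidableEquality)
open import Relation.Binary.PropositionalEquality
open import Relation.Nullary using (¬_; Dec; yes; no; contradiction)
open import Relation.Nullary.Decidable using (_×-dec_)
open import Relation.Unary using (Decidable)
open import Algebra.Solver.Ring.AlmostCommutativeRing using (fromCommutativeRing)
import Algebra.Solver.Ring.Simple as RingSolver

open RingSolver (fromCommutativeRing xor-∧-commutativeRing) Bool._≟_ using (solve; _:=_; _:+_)

private
  variable
    n d : ℕ

-- Vectors over F₂

xor≡false⇒≡ : {x y : Bool} → x xor y ≡ false → x ≡ y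
xor≡false⇒≡ {false} eq = sym eq
xor≡false⇒≡ {true} {true} _ = refl

⊕-assoc : (x y z : Vector n) → (x ⊕ y) ⊕ z ≡ x ⊕ (y ⊕ z)
⊕-assoc = zipWith-assoc xor-assoc

⊕-comm : (x y : Vector n) → x ⊕ y ≡ y ⊕ x
⊕-comm = zipWith-comm xor-comm

⊕-identityˡ : (x : Vector n) → 0v ⊕ x ≡ x
⊕-identityˡ = zipWith-identityˡ (λ _ → refl)

⊕-identityʳ : (x : Vector n) → x ⊕ 0v ≡ x
⊕-identityʳ = zipWith-identityʳ Bool.xor-identityʳ

⊕-same : (x : Vector n) → x ⊕ x ≡ 0v
⊕-same [] = refl
⊕-same (b ∷ x) = cong₂ _∷_ (xor-same b) (⊕-same x)

⊕-cancelˡ : (x y : Vector n) → x ⊕ (x ⊕ y) ≡ y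
⊕-cancelˡ x y = begin
  x ⊕ (x ⊕ y)  ≡⟨ ⊕-assoc x x y ⟨
  (x ⊕ x) ⊕ y  ≡⟨ cong (_⊕ y) (⊕-same x) ⟩
  0v ⊕ y       ≡⟨ ⊕-identityˡ y ⟩
  y            ∎
  where open ≡-Reasoning

⊕-cancelʳ : (x y : Vector n) → (x ⊕ y) ⊕ y ≡ x
⊕-cancelʳ x y = trans (⊕-comm (x ⊕ y) y) (trans (cong (y ⊕_) (⊕-comm x y)) (⊕-cancelˡ y x))

⊕≡0v⇒≡ : (x y : Vector n) → x ⊕ y ≡ 0v → x ≡ y
⊕≡0v⇒≡ x y eq = trans (sym (⊕-cancelʳ x y)) (trans (cong (_⊕ y) eq) (⊕-identityˡ y))

_≟v_ : DecidableEquality (Vector n)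
_≟v_ = Vec.≡-dec Bool._≟_

==v⇒≡ : (u v : Vector n) → (u ==v v) ≡ true → u ≡ v
==v⇒≡ [] [] _ = refl
==v⇒≡ (true ∷ u) (true ∷ v) eq = cong (true ∷_) (==v⇒≡ u v eq)
==v⇒≡ (false ∷ u) (false ∷ v) eq = cong (false ∷_) (==v⇒≡ u v eq)

==v-refl : (u : Vector n) → (u ==v u) ≡ true
==v-refl [] = refl
==v-refl (true ∷ u) = ==v-refl u
==v-refl (false ∷ u) = ==v-refl u

isZero⇒≡0v : (v : Vector n) → isZero v ≡ true → v ≡ 0v
isZero⇒≡0v v = ==v⇒≡ v 0v

isZero-0v : isZero (0v {n}) ≡ true
isZero-0v {n} = ==v-refl (0v {n})

≢0v⇒¬isZero : (v : Vector n) → v ≢ 0v → isZero v ≡ false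
≢0v⇒¬isZero v v≢0 = Bool.¬-not (v≢0 ∘ isZero⇒≡0v v)

-- Enumeration and counting

∈-allVecs : (v : Vector n) → v ∈ allVecs n
∈-allVecs [] = here refl
∈-allVecs {suc n} (false ∷ v) = ∈-++⁺ˡ (∈-map⁺ (false ∷_) (∈-allVecs v))
∈-allVecs {suc n} (true ∷ v) = ∈-++⁺ʳ (map (false ∷_) (allVecs n)) (∈-map⁺ (true ∷_) (∈-allVecs v))

allVecs-unique : ∀ n → Unique (allVecs n)
allVecs-unique zero = [] ∷ []
allVecs-unique (suc n) = Unique.++⁺ (Unique.map⁺ Vec.∷-injectiveʳ (allVecs-unique n))
  (Unique.map⁺ Vec.∷-injectiveʳ (allVecs-unique n)) heads-differ
  where
  heads-differ : ∀ {v} → ¬ (v ∈ map (false ∷_) (allVecs n) × v ∈ map (true ∷_) (allVecs n))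
  heads-differ (v∈₀ , v∈₁) with ∈-map⁻ (false ∷_) v∈₀ | ∈-map⁻ (true ∷_) v∈₁
  ... | _ , _ , refl | _ , _ , ()

length-allVecs : ∀ n → length (allVecs n) ≡ 2 ^ n
length-allVecs zero = refl
length-allVecs (suc n) = begin
  length (map (false ∷_) (allVecs n) ++ map (true ∷_) (allVecs n))
    ≡⟨ length-++ (map (false ∷_) (allVecs n)) ⟩
  length (map (false ∷_) (allVecs n)) + length (map (true ∷_) (allVecs n))
    ≡⟨ cong₂ _+_ (length-map _ (allVecs n)) (length-map _ (allVecs n)) ⟩
  length (allVecs n) + length (allVecs n)
    ≡⟨ cong (λ k → k + k) (length-allVecs n) ⟩
  2 ^ n + 2 ^ n
    ≡⟨ cong (2 ^ n +_) (+-identityʳ (2 ^ n)) ⟨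
  2 ^ suc n ∎
  where open ≡-Reasoning

∃?-Vector : {P : Vector n → Set} → Decidable P → Dec (∃ P)
∃?-Vector {n} P? with any? P? (allVecs n)
... | yes some = yes (satisfied some)
... | no none = no λ (v , pv) → none (lose (∈-allVecs v) pv)

anyL≡true⇒ : {A : Set} (p : A → Bool) (xs : List A) → anyL p xs ≡ true → ∃ λ x → p x ≡ true
anyL≡true⇒ p (x ∷ xs) eq with p x in px
... | true = x , px
... | false = anyL≡true⇒ p xs eq

∈⇒anyL≡true : {A : Set} (p : A → Bool) {x : A} {xs : List A} → x ∈ xs → p x ≡ true → anyL p xs ≡ true
∈⇒anyL≡true p (here refl) px rewrite px = refl
∈⇒anyL≡true p {xs = y ∷ _} (there x∈) px rewrite ∈⇒anyL≡true p x∈ px = Bool.∨-zeroʳ (p y)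

module _ {A : Set} (_≟_ : DecidableEquality A) where

  unique-⊆⇒length≤ : {xs ys : List A} → Unique xs → xs ⊆ ys → length xs ≤ length ys
  unique-⊆⇒length≤ {xs} {ys} xs! xs⊆ys = begin
    length xs                 ≡⟨ ↭-length (∼bag⇒↭ (unique∧set⇒bag xs! ys′! same)) ⟩
    length ys′                ≤⟨ length-filter (_∈? xs) (deduplicate _≟_ ys) ⟩
    length (deduplicate _≟_ ys) ≤⟨ length-deduplicate _≟_ ys ⟩
    length ys                 ∎
    where
    open ≤-Reasoning
    open DecMembership _≟_ using (_∈?_)
    ys′ : List A
    ys′ = filter (_∈? xs) (deduplicate _≟_ ys)
    ys′! : Unique ys′
    ys′! = Unique.filter⁺ (_∈? xs) (deduplicate-! _≟_ ys)
    same : ∀ {x} → x ∈ xs ⇔ x ∈ ys′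
    same = mk⇔ (λ x∈ → ∈-filter⁺ (_∈? xs) (∈-deduplicate⁺ _≟_ (xs⊆ys x∈)) x∈)
               (proj₂ ∘ ∈-filter⁻ (_∈? xs) {xs = deduplicate _≟_ ys})

countL≡length-filter : {A : Set} (p : A → Bool) (xs : List A) →
  countL p xs ≡ length (filter (λ x → p x Bool.≟ true) xs)
countL≡length-filter p [] = refl
countL≡length-filter p (x ∷ xs) with p x
... | true = cong suc (countL≡length-filter p xs)
... | false = countL≡length-filter p xs

isOdd : ℕ → Bool
isOdd zero = false
isOdd (suc k) = not (isOdd k)

isOdd-even : {k : ℕ} → 2 ∣ k → isOdd k ≡ false
isOdd-even (divides q refl) = go q
  where
  go : ∀ q → isOdd (q * 2) ≡ false
  go zero = refl
  go (suc q) = trans (Bool.not-involutive _) (go q)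

isOdd-countL : {A : Set} (p : A → Bool) (xs : List A) →
  isOdd (countL p xs) ≡ foldr (λ x b → p x xor b) false xs
isOdd-countL p [] = refl
isOdd-countL p (x ∷ xs) with p x
... | true = cong not (isOdd-countL p xs)
... | false = isOdd-countL p xs

-- Linear algebra over F₂

infixr 7 _·_
_·_ : Bool → Vector n → Vector n
c · x = if c then x else 0v

·-xor : (a b : Bool) (x : Vector n) → (a xor b) · x ≡ a · x ⊕ b · x
·-xor true true x = sym (⊕-same x)
·-xor true false x = sym (⊕-identityʳ x)
·-xor false b x = sym (⊕-identityˡ (b · x))

⊕-interchange : (a b c e : Vector n) → (a ⊕ b) ⊕ (c ⊕ e) ≡ (a ⊕ c) ⊕ (b ⊕ e)
⊕-interchange a b c e = begin
  (a ⊕ b) ⊕ (c ⊕ e)  ≡⟨ ⊕-assoc a b (c ⊕ e) ⟩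
  a ⊕ (b ⊕ (c ⊕ e))  ≡⟨ cong (a ⊕_) (⊕-assoc b c e) ⟨
  a ⊕ ((b ⊕ c) ⊕ e)  ≡⟨ cong (λ z → a ⊕ (z ⊕ e)) (⊕-comm b c) ⟩
  a ⊕ ((c ⊕ b) ⊕ e)  ≡⟨ cong (a ⊕_) (⊕-assoc c b e) ⟩
  a ⊕ (c ⊕ (b ⊕ e))  ≡⟨ ⊕-assoc a c (b ⊕ e) ⟨
  (a ⊕ c) ⊕ (b ⊕ e)  ∎
  where open ≡-Reasoning

comb-0v : (b : Vec (Vector n) d) → comb 0v b ≡ 0v
comb-0v [] = refl
comb-0v (x ∷ b) = trans (⊕-identityˡ _) (comb-0v b)

comb-⊕ : (c c′ : Vec Bool d) (b : Vec (Vector n) d) → comb (c ⊕ c′) b ≡ comb c b ⊕ comb c′ b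
comb-⊕ [] [] [] = sym (⊕-identityˡ 0v)
comb-⊕ (a ∷ c) (a′ ∷ c′) (x ∷ b) = begin
  (a xor a′) · x ⊕ comb (c ⊕ c′) b
    ≡⟨ cong₂ _⊕_ (·-xor a a′ x) (comb-⊕ c c′ b) ⟩
  (a · x ⊕ a′ · x) ⊕ (comb c b ⊕ comb c′ b)
    ≡⟨ ⊕-interchange (a · x) (a′ · x) (comb c b) (comb c′ b) ⟩
  (a · x ⊕ comb c b) ⊕ (a′ · x ⊕ comb c′ b) ∎
  where open ≡-Reasoning

comb-injective : {b : Vec (Vector n) d} → LinIndep b → {c c′ : Vec Bool d} → comb c b ≡ comb c′ b → c ≡ c′
comb-injective {b = b} indep {c} {c′} eq =
  ⊕≡0v⇒≡ c c′ (indep (c ⊕ c′) (trans (comb-⊕ c c′ b) (trans (cong (_⊕ comb c′ b) eq) (⊕-same _))))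

inSpan⇒comb : (b : Vec (Vector n) d) {x : Vector n} → inSpan b x ≡ true → ∃ λ c → comb c b ≡ x
inSpan⇒comb b {x} x∈ = let c , eq = anyL≡true⇒ _ (allVecs _) x∈ in c , ==v⇒≡ _ x eq

comb∈span : (b : Vec (Vector n) d) (c : Vec Bool d) → inSpan b (comb c b) ≡ true
comb∈span b c = ∈⇒anyL≡true (λ c′ → comb c′ b ==v comb c b) (∈-allVecs c) (==v-refl (comb c b))

comb≡⇒inSpan : (b : Vec (Vector n) d) (c : Vec Bool d) {x : Vector n} → comb c b ≡ x → inSpan b x ≡ true
comb≡⇒inSpan b c refl = comb∈span b c

0v∈span : (b : Vec (Vector n) d) → inSpan b 0v ≡ true
0v∈span b = comb≡⇒inSpan b 0v (comb-0v b)

⊕∈span : (b : Vec (Vector n) d) {x y : Vector n} →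
  inSpan b x ≡ true → inSpan b y ≡ true → inSpan b (x ⊕ y) ≡ true
⊕∈span b x∈ y∈ with inSpan⇒comb b x∈ | inSpan⇒comb b y∈
... | c , refl | c′ , refl = comb≡⇒inSpan b (c ⊕ c′) (comb-⊕ c c′ b)

⊕∉span : (b : Vec (Vector n) d) {x y : Vector n} →
  inSpan b x ≡ false → inSpan b y ≡ true → inSpan b (x ⊕ y) ≡ false
⊕∉span b {x} {y} x∉ y∈ = Bool.¬-not λ x⊕y∈ →
  Bool.not-¬ x∉ (subst (λ z → inSpan b z ≡ true) (⊕-cancelʳ x y) (⊕∈span b x⊕y∈ y∈))

LinIndep-∷ : {b : Vec (Vector n) d} {x : Vector n} → LinIndep b → inSpan b x ≡ false → LinIndep (x ∷ b)
LinIndep-∷ {b = b} {x} indep x∉ (true ∷ c) eq =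
  contradiction (comb≡⇒inSpan b c (sym (⊕≡0v⇒≡ x (comb c b) eq))) (Bool.not-¬ x∉)
LinIndep-∷ indep x∉ (false ∷ c) eq = cong (false ∷_) (indep c (trans (sym (⊕-identityˡ _)) eq))

spanList : Vec (Vector n) d → List (Vector n)
spanList {d = d} b = map (λ c → comb c b) (allVecs d)

length-spanList : (b : Vec (Vector n) d) → length (spanList b) ≡ 2 ^ d
length-spanList {d = d} b = trans (length-map _ (allVecs d)) (length-allVecs d)

spanList-unique : {b : Vec (Vector n) d} → LinIndep b → Unique (spanList b)
spanList-unique {d = d} indep = Unique.map⁺ (comb-injective indep) (allVecs-unique d)

inSpan⇒∈spanList : (b : Vec (Vector n) d) {x : Vector n} → inSpan b x ≡ true → x ∈ spanList b
inSpan⇒∈spanList b x∈ with inSpan⇒comb b x∈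
... | c , refl = ∈-map⁺ (λ c → comb c b) (∈-allVecs c)

∈spanList⇒inSpan : (b : Vec (Vector n) d) {x : Vector n} → x ∈ spanList b → inSpan b x ≡ true
∈spanList⇒inSpan b x∈ with ∈-map⁻ (λ c → comb c b) x∈
... | c , _ , refl = comb∈span b c

2^-cancel-≤ : {a b : ℕ} → 2 ^ a ≤ 2 ^ b → a ≤ b
2^-cancel-≤ {a} {b} le with a ≤? b
... | yes a≤b = a≤b
... | no a≰b = contradiction le (<⇒≱ (^-monoʳ-< 2 (s≤s (s≤s z≤n)) (≰⇒> a≰b)))

unique⊆span⇒length≤2^ : {xs : List (Vector n)} (g : Vec (Vector n) d) → Unique xs →
  (∀ {x} → x ∈ xs → inSpan g x ≡ true) → length xs ≤ 2 ^ d
unique⊆span⇒length≤2^ g xs! xs⊆span =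
  ≤-trans (unique-⊆⇒length≤ _≟v_ xs! (inSpan⇒∈spanList g ∘ xs⊆span)) (≤-reflexive (length-spanList g))

LinIndep⇒≤ : {d₁ d₂ : ℕ} {f : Vec (Vector n) d₁} (g : Vec (Vector n) d₂) → LinIndep f →
  (∀ {x} → inSpan f x ≡ true → inSpan g x ≡ true) → d₁ ≤ d₂
LinIndep⇒≤ {f = f} g indep f⊆g = 2^-cancel-≤ (subst (_≤ _) (length-spanList f)
  (unique⊆span⇒length≤2^ g (spanList-unique indep) (f⊆g ∘ ∈spanList⇒inSpan f)))

LinIndep⇒≤dim : {f : Vec (Vector n) d} → LinIndep f → d ≤ n
LinIndep⇒≤dim {n} {f = f} indep = 2^-cancel-≤ (subst₂ _≤_ (length-spanList f) (length-allVecs n)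
  (unique-⊆⇒length≤ _≟v_ (spanList-unique indep) (λ {x} _ → ∈-allVecs x)))

∃∉span : d < n → (g : Vec (Vector n) d) → ∃ λ u → inSpan g u ≡ false
∃∉span {d} {n} d<n g with ∃?-Vector (λ u → inSpan g u Bool.≟ false)
... | yes outside = outside
... | no none = contradiction (2^-cancel-≤ (subst (_≤ 2 ^ d) (length-allVecs n)
        (unique⊆span⇒length≤2^ g (allVecs-unique n) λ {x} _ → Bool.¬-not λ x∉ → none (x , x∉))))
        (<⇒≱ d<n)

hyperplane-complement : {m : ℕ} {h : Vec (Vector (suc m)) m} {w y : Vector (suc m)} → LinIndep h →
  inSpan h w ≡ false → inSpan h y ≡ false → inSpan h (w ⊕ y) ≡ true
hyperplane-complement {m} {h} {w} {y} indep w∉ y∉ = Bool.¬-not λ w⊕y∉ →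
  contradiction (LinIndep⇒≤dim (LinIndep-∷ (LinIndep-∷ indep w∉) (y∉span w⊕y∉))) (n≮n (suc m))
  where
  y∉span : inSpan h (w ⊕ y) ≡ false → inSpan (w ∷ h) y ≡ false
  y∉span w⊕y∉ = Bool.¬-not λ y∈ → case inSpan⇒comb (w ∷ h) y∈ of λ where
    (true ∷ c , eq) → Bool.not-¬ w⊕y∉ (comb≡⇒inSpan h c (trans (sym (⊕-cancelˡ w _)) (cong (w ⊕_) eq)))
    (false ∷ c , eq) → Bool.not-¬ y∉ (comb≡⇒inSpan h c (trans (sym (⊕-identityˡ _)) eq))

record IsSubspace (Z : Vector n → Bool) : Set where
  field
    0v∈ : Z 0v ≡ true
    ⊕∈ : ∀ {x y} → Z x ≡ true → Z y ≡ true → Z (x ⊕ y) ≡ true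

record Basis (Z : Vector n → Bool) : Set where
  field
    dim : ℕ
    basis : Vec (Vector n) dim
    independent : LinIndep basis
    spans : ∀ x → inSpan basis x ≡ Z x

module _ {Z : Vector n → Bool} (Z-subspace : IsSubspace Z) where
  open IsSubspace Z-subspace

  comb∈subspace : {f : Vec (Vector n) d} → VecAll (λ x → Z x ≡ true) f →
    (c : Vec Bool d) → Z (comb c f) ≡ true
  comb∈subspace [] [] = 0v∈
  comb∈subspace (x∈ ∷ f⊆Z) (true ∷ c) = ⊕∈ x∈ (comb∈subspace f⊆Z c)
  comb∈subspace (x∈ ∷ f⊆Z) (false ∷ c) = ⊕∈ 0v∈ (comb∈subspace f⊆Z c)

  private
    grow : (k : ℕ) (f : Vec (Vector n) d) → n ≤ k + d → LinIndep f → VecAll (λ x → Z x ≡ true) f → Basis Z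
    grow k f bound indep f⊆Z with ∃?-Vector (λ x → Z x Bool.≟ true ×-dec inSpan f x Bool.≟ false)
    ... | no none = record { basis = f ; independent = indep ; spans = spans }
      where
      spans : ∀ x → inSpan f x ≡ Z x
      spans x with inSpan f x in x∈? | Z x in Zx
      ... | true | _ = let c , eq = inSpan⇒comb f x∈? in trans (sym (comb∈subspace f⊆Z c)) (trans (cong Z eq) Zx)
      ... | false | false = refl
      ... | false | true = contradiction (x , Zx , x∈?) none
    grow zero f bound indep f⊆Z | yes (x , _ , x∉) =
      contradiction (LinIndep⇒≤dim (LinIndep-∷ indep x∉)) (<⇒≱ (s≤s bound))
    grow (suc k) f bound indep f⊆Z | yes (x , Zx , x∉) =
      grow k (x ∷ f) (subst (n ≤_) (sym (+-suc k _)) bound) (LinIndep-∷ indep x∉) (Zx ∷ f⊆Z)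

  subspace-basis : Basis Z
  subspace-basis = grow n [] (≤-reflexive (sym (+-identityʳ n))) (λ { [] _ → refl }) []

span-isSubspace : (b : Vec (Vector n) d) → IsSubspace (inSpan b)
span-isSubspace b = record { 0v∈ = 0v∈span b ; ⊕∈ = ⊕∈span b }

span-mono : {k : ℕ} {f : Vec (Vector n) d} (h : Vec (Vector n) k) → VecAll (λ x → inSpan h x ≡ true) f →
  {x : Vector n} → inSpan f x ≡ true → inSpan h x ≡ true
span-mono {f = f} h f⊆h x∈ with inSpan⇒comb f x∈
... | c , refl = comb∈subspace (span-isSubspace h) f⊆h c

kernel : {k : ℕ} → Vec (Vector n) k → (Vector n → Bool) → Vector n → Bool
kernel h l x = inSpan h x ∧ not (l x)

KernelClosed : {k : ℕ} → Vec (Vector n) k → (Vector n → Bool) → Set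
KernelClosed h l =
  ∀ {a b} → inSpan h a ≡ true → inSpan h b ≡ true → l a ≡ false → l b ≡ false → l (a ⊕ b) ≡ false

module _ {k : ℕ} (h : Vec (Vector n) k) (l : Vector n → Bool) where

  kernel-intro : {x : Vector n} → inSpan h x ≡ true → l x ≡ false → kernel h l x ≡ true
  kernel-intro x∈ lx rewrite x∈ | lx = refl

  kernel-inSpan : {x : Vector n} → kernel h l x ≡ true → inSpan h x ≡ true
  kernel-inSpan {x} = Bool.∧-conicalˡ (inSpan h x) _

  kernel-vanishes : {x : Vector n} → kernel h l x ≡ true → l x ≡ false
  kernel-vanishes {x} x∈ = Bool.¬-not λ lx → Bool.not-¬ (Bool.∧-conicalʳ (inSpan h x) _ x∈) (cong not lx)

  kernel-isSubspace : l 0v ≡ false → KernelClosed h l → IsSubspace (kernel h l)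
  kernel-isSubspace l-0v l-closed = record
    { 0v∈ = kernel-intro (0v∈span h) l-0v
    ; ⊕∈ = λ a∈ b∈ → kernel-intro (⊕∈span h (kernel-inSpan a∈) (kernel-inSpan b∈))
             (l-closed (kernel-inSpan a∈) (kernel-inSpan b∈) (kernel-vanishes a∈) (kernel-vanishes b∈))
    }

module _ {m : ℕ} (h : Vec (Vector n) m) (l : Vector n → Bool)
         (l-additive : ∀ {a b} → inSpan h a ≡ true → inSpan h b ≡ true → l (a ⊕ b) ≡ l a xor l b) where

  additive-0v : l 0v ≡ false
  additive-0v = begin
    l 0v            ≡⟨ cong l (⊕-same 0v) ⟨
    l (0v ⊕ 0v)     ≡⟨ l-additive (0v∈span h) (0v∈span h) ⟩
    l 0v xor l 0v   ≡⟨ Bool.xor-same (l 0v) ⟩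
    false           ∎
    where open ≡-Reasoning

  additive-kernel-isSubspace : IsSubspace (kernel h l)
  additive-kernel-isSubspace = kernel-isSubspace h l additive-0v
    λ a∈ b∈ la lb → trans (l-additive a∈ b∈) (cong₂ _xor_ la lb)

  kernel-codim₁ : LinIndep h → {x₀ : Vector n} → inSpan h x₀ ≡ true → l x₀ ≡ true →
    (B : Basis (kernel h l)) → suc (Basis.dim B) ≡ m
  kernel-codim₁ h-independent {x₀} x₀∈ lx₀ B =
    ≤-antisym (LinIndep⇒≤ h x₀∷f-independent x₀∷f⊆h)
              (LinIndep⇒≤ (x₀ ∷ f) h-independent h⊆x₀∷f)
    where
    open Basis B renaming (basis to f)
    x₀∷f-independent : LinIndep (x₀ ∷ f)
    x₀∷f-independent = LinIndep-∷ independent (trans (spans x₀) (cong₂ (λ p q → p ∧ not q) x₀∈ lx₀))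
    f⊆h : {x : Vector n} → inSpan f x ≡ true → inSpan h x ≡ true
    f⊆h {x} x∈ = kernel-inSpan h l (trans (sym (spans x)) x∈)
    x₀∷f⊆h : {x : Vector n} → inSpan (x₀ ∷ f) x ≡ true → inSpan h x ≡ true
    x₀∷f⊆h x∈ with inSpan⇒comb (x₀ ∷ f) x∈
    ... | true ∷ c , refl = ⊕∈span h x₀∈ (f⊆h (comb∈span f c))
    ... | false ∷ c , refl = ⊕∈span h (0v∈span h) (f⊆h (comb∈span f c))
    h⊆x₀∷f : {x : Vector n} → inSpan h x ≡ true → inSpan (x₀ ∷ f) x ≡ true
    h⊆x₀∷f {x} x∈ with l x in lx
    ... | false = let c , eq = inSpan⇒comb f (trans (spans x) (kernel-intro h l x∈ lx)) in
      comb≡⇒inSpan (x₀ ∷ f) (false ∷ c) (trans (⊕-identityˡ _) eq)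
    ... | true = let c , eq = inSpan⇒comb f x₀⊕x∈f in
      comb≡⇒inSpan (x₀ ∷ f) (true ∷ c) (trans (cong (x₀ ⊕_) eq) (⊕-cancelˡ x₀ x))
      where
      x₀⊕x∈f : inSpan f (x₀ ⊕ x) ≡ true
      x₀⊕x∈f = trans (spans (x₀ ⊕ x))
        (kernel-intro h l (⊕∈span h x₀∈ x∈) (trans (l-additive x₀∈ x∈) (cong₂ _xor_ lx₀ lx)))

⊆F-intro : {k : ℕ} {f : Vec (Vector n) d} {h : Vec (Vector n) k} →
  (∀ {x} → inSpan f x ≡ true → inSpan h x ≡ true) → f ⊆F h
⊆F-intro {f = f} f⊆h x x∈ =
  trans (cong (_∧ _) (f⊆h (Bool.∧-conicalˡ (inSpan f x) _ x∈))) (Bool.∧-conicalʳ (inSpan f x) _ x∈)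

≢0v⇒inFlat≡inSpan : (b : Vec (Vector n) d) {x : Vector n} → x ≢ 0v → inFlat b x ≡ inSpan b x
≢0v⇒inFlat≡inSpan b {x} x≢0 =
  trans (cong (λ z → inSpan b x ∧ not z) (≢0v⇒¬isZero x x≢0)) (Bool.∧-identityʳ _)

inFlat-0v : (b : Vec (Vector n) d) → inFlat b 0v ≡ false
inFlat-0v {n} b = trans (cong (λ z → inSpan b 0v ∧ not z) (isZero-0v {n})) (Bool.∧-zeroʳ _)

count-on-flat : {P : Vector n → Bool} (b : Vec (Vector n) d) → LinIndep b → P 0v ≡ false →
  count (λ x → P x ∧ inFlat b x) ≡ count (λ c → P (comb c b))
count-on-flat {n} {d} {P} b indep P0 = begin
  count Q                     ≡⟨ countL≡length-filter Q (allVecs n) ⟩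
  length on-flat              ≡⟨ ≤-antisym (unique-⊆⇒length≤ _≟v_ on-flat! on-flat⊆combs)
                                            (unique-⊆⇒length≤ _≟v_ combs! combs⊆on-flat) ⟩
  length combs                ≡⟨ length-map (λ c → comb c b) coords ⟩
  length coords               ≡⟨ countL≡length-filter (P ∘ (λ c → comb c b)) (allVecs d) ⟨
  count (λ c → P (comb c b))  ∎
  where
  open ≡-Reasoning
  Q : Vector n → Bool
  Q x = P x ∧ inFlat b x
  on-flat : List (Vector n)
  on-flat = filter (λ x → Q x Bool.≟ true) (allVecs n)
  coords : List (Vec Bool d)
  coords = filter (λ c → P (comb c b) Bool.≟ true) (allVecs d)
  combs : List (Vector n)
  combs = map (λ c → comb c b) coords
  on-flat! : Unique on-flat
  on-flat! = Unique.filter⁺ _ (allVecs-unique n)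
  combs! : Unique combs
  combs! = Unique.map⁺ (comb-injective indep) (Unique.filter⁺ _ (allVecs-unique d))
  on-flat⊆combs : on-flat ⊆ combs
  on-flat⊆combs {x} x∈ with proj₂ (∈-filter⁻ (λ x → Q x Bool.≟ true) {xs = allVecs n} x∈)
  ... | Qx with inSpan⇒comb b {x} (Bool.∧-conicalˡ (inSpan b x) _ (Bool.∧-conicalʳ (P x) _ Qx))
  ... | c , refl = ∈-map⁺ (λ c → comb c b) (∈-filter⁺ _ (∈-allVecs c) (Bool.∧-conicalˡ _ _ Qx))
  combs⊆on-flat : combs ⊆ on-flat
  combs⊆on-flat x∈ with ∈-map⁻ (λ c → comb c b) x∈
  ... | c , c∈ , refl = ∈-filter⁺ _ (∈-allVecs (comb c b)) Qx
    where
    Pc : P (comb c b) ≡ true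
    Pc = proj₂ (∈-filter⁻ (λ c → P (comb c b) Bool.≟ true) {xs = allVecs d} c∈)
    nonzero : isZero (comb c b) ≡ false
    nonzero = ≢0v⇒¬isZero (comb c b) λ c≡0 → Bool.not-¬ P0 (subst (λ z → P z ≡ true) c≡0 Pc)
    Qx : Q (comb c b) ≡ true
    Qx rewrite Pc | comb∈span b c | nonzero = refl

-- Matroids in E₃

E∧inFlat≡inSpan∧E : {E : Vector n → Bool} → IsMatroid E → (b : Vec (Vector n) d) (x : Vector n) →
  E x ∧ inFlat b x ≡ inSpan b x ∧ E x
E∧inFlat≡inSpan∧E matroid b x with x ≟v 0v
... | yes refl rewrite matroid = sym (Bool.∧-zeroʳ (inSpan b 0v))
... | no x≢0 rewrite ≢0v⇒inFlat≡inSpan b x≢0 = Bool.∧-comm _ (inSpan b x)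

module Even3Flats {E : Vector n → Bool} (matroid : IsMatroid E) (e3 : InE3 E) where

  parity-on-3-flat : {w a b : Vector n} → LinIndep (w ∷ a ∷ b ∷ []) →
    E b xor E a xor E (a ⊕ b) xor E w xor E (w ⊕ b) xor E (w ⊕ a) xor E (w ⊕ (a ⊕ b)) ≡ false
  parity-on-3-flat {w} {a} {b} indep =
    -- the terms of points-sum are E (comb c bs) for c = 000, 001, …, 111 in this order
    same-terms (trans (cong E (trans (⊕-identityˡ _) (trans (⊕-identityˡ _) (⊕-identityˡ 0v)))) matroid)
      (cong E (trans (⊕-identityˡ _) (trans (⊕-identityˡ _) (⊕-identityʳ b))))
      (cong E (trans (⊕-identityˡ _) (trans (cong (a ⊕_) (⊕-identityˡ 0v)) (⊕-identityʳ a))))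
      (cong E (trans (⊕-identityˡ _) (cong (a ⊕_) (⊕-identityʳ b))))
      (cong E (trans (cong (w ⊕_) (trans (⊕-identityˡ _) (⊕-identityˡ 0v))) (⊕-identityʳ w)))
      (cong E (cong (w ⊕_) (trans (⊕-identityˡ _) (⊕-identityʳ b))))
      (cong E (cong (w ⊕_) (trans (cong (a ⊕_) (⊕-identityˡ 0v)) (⊕-identityʳ a))))
      (cong E (cong (w ⊕_) (cong (a ⊕_) (⊕-identityʳ b))))
      points-sum
    where
    bs : Vec (Vector n) 3
    bs = w ∷ a ∷ b ∷ []
    points-sum : foldr (λ c r → E (comb c bs) xor r) false (allVecs 3) ≡ false
    points-sum = begin
      foldr (λ c r → E (comb c bs) xor r) false (allVecs 3)
        ≡⟨ isOdd-countL (λ c → E (comb c bs)) (allVecs 3) ⟨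
      isOdd (count (λ c → E (comb c bs)))
        ≡⟨ cong isOdd (count-on-flat {P = E} bs indep matroid) ⟨
      isOdd (count (λ x → E x ∧ inFlat bs x))
        ≡⟨ isOdd-even (e3 3 (s≤s (s≤s (s≤s z≤n))) bs indep) ⟩
      false ∎
      where open ≡-Reasoning
    same-terms : ∀ {q₀ q₁ q₂ q₃ q₄ q₅ q₆ q₇ r₁ r₂ r₃ r₄ r₅ r₆ r₇ : Bool} →
      q₀ ≡ false → q₁ ≡ r₁ → q₂ ≡ r₂ → q₃ ≡ r₃ → q₄ ≡ r₄ → q₅ ≡ r₅ → q₆ ≡ r₆ → q₇ ≡ r₇ →
      q₀ xor q₁ xor q₂ xor q₃ xor q₄ xor q₅ xor q₆ xor q₇ xor false ≡ false →
      r₁ xor r₂ xor r₃ xor r₄ xor r₅ xor r₆ xor r₇ ≡ false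
    same-terms {r₇ = r₇} refl refl refl refl refl refl refl refl sum
      rewrite Bool.xor-identityʳ r₇ = sum

  Δ : Vector n → Vector n → Bool
  Δ w x = E (w ⊕ x) xor E x

  Δ-0v : (w : Vector n) → Δ w 0v ≡ E w
  Δ-0v w = trans (cong₂ _xor_ (cong E (⊕-identityʳ w)) matroid) (Bool.xor-identityʳ (E w))

  Δ-affine : {k : ℕ} (h : Vec (Vector n) k) {w a b : Vector n} → inSpan h w ≡ false →
    inSpan h a ≡ true → inSpan h b ≡ true → Δ w (a ⊕ b) ≡ Δ w a xor Δ w b xor E w
  Δ-affine h {w} {a} {b} w∉ a∈ b∈ with a ≟v 0v | b ≟v 0v | a ≟v b
  ... | yes refl | _ | _ = begin
    Δ w (0v ⊕ b)                  ≡⟨ cong (Δ w) (⊕-identityˡ b) ⟩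
    Δ w b                         ≡⟨ solve 2 (λ x y → y := x :+ (y :+ x)) refl (E w) (Δ w b) ⟩
    E w xor Δ w b xor E w         ≡⟨ cong (λ z → z xor Δ w b xor E w) (Δ-0v w) ⟨
    Δ w 0v xor Δ w b xor E w      ∎
    where open ≡-Reasoning
  ... | no _ | yes refl | _ = begin
    Δ w (a ⊕ 0v)                  ≡⟨ cong (Δ w) (⊕-identityʳ a) ⟩
    Δ w a                         ≡⟨ solve 2 (λ x y → y := y :+ (x :+ x)) refl (E w) (Δ w a) ⟩
    Δ w a xor E w xor E w         ≡⟨ cong (λ z → Δ w a xor z xor E w) (Δ-0v w) ⟨
    Δ w a xor Δ w 0v xor E w      ∎
    where open ≡-Reasoning
  ... | no _ | no _ | yes refl = begin
    Δ w (a ⊕ a)                   ≡⟨ cong (Δ w) (⊕-same a) ⟩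
    Δ w 0v                        ≡⟨ Δ-0v w ⟩
    E w                           ≡⟨ solve 2 (λ x y → x := y :+ (y :+ x)) refl (E w) (Δ w a) ⟩
    Δ w a xor Δ w a xor E w       ∎
    where open ≡-Reasoning
  ... | no a≢0 | no b≢0 | no a≢b = xor≡false⇒≡ (trans regroup (parity-on-3-flat independent))
    where
    regroup : Δ w (a ⊕ b) xor (Δ w a xor Δ w b xor E w) ≡
      E b xor E a xor E (a ⊕ b) xor E w xor E (w ⊕ b) xor E (w ⊕ a) xor E (w ⊕ (a ⊕ b))
    regroup = solve 7 (λ ea eb eab ew ewa ewb ewab →
      (ewab :+ eab) :+ ((ewa :+ ea) :+ ((ewb :+ eb) :+ ew))
        := eb :+ (ea :+ (eab :+ (ew :+ (ewb :+ (ewa :+ ewab))))))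
      refl (E a) (E b) (E (a ⊕ b)) (E w) (E (w ⊕ a)) (E (w ⊕ b)) (E (w ⊕ (a ⊕ b)))
    independent : LinIndep (w ∷ a ∷ b ∷ [])
    independent = LinIndep-∷ (LinIndep-∷ (LinIndep-∷ (λ { [] _ → refl }) b∉) a∉) w∉ab
      where
      b∉ : inSpan [] b ≡ false
      b∉ = Bool.¬-not λ b∈ → case inSpan⇒comb [] b∈ of λ where
        ([] , eq) → b≢0 (sym eq)
      a∉ : inSpan (b ∷ []) a ≡ false
      a∉ = Bool.¬-not λ a∈ → case inSpan⇒comb (b ∷ []) a∈ of λ where
        (true ∷ [] , eq) → a≢b (trans (sym eq) (⊕-identityʳ b))
        (false ∷ [] , eq) → a≢0 (trans (sym eq) (⊕-identityˡ 0v))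
      w∉ab : inSpan (a ∷ b ∷ []) w ≡ false
      w∉ab = Bool.¬-not λ w∈ → Bool.not-¬ w∉ (span-mono h (a∈ ∷ b∈ ∷ []) w∈)

module OverHyperplane {m : ℕ} {E : Vector (suc m) → Bool} (matroid : IsMatroid E) (e3 : InE3 E)
         {h : Vec (Vector (suc m)) m} (h-independent : LinIndep h) where
  open Even3Flats {E = E} matroid e3

  NontrivialShift : Vector (suc m) → Set
  NontrivialShift w = inSpan h w ≡ false × E w ≡ false × ∃ λ x → inSpan h x ≡ true × Δ w x ≡ true

  nontrivialShift? : Dec (∃ NontrivialShift)
  nontrivialShift? = ∃?-Vector λ w →
    inSpan h w Bool.≟ false ×-dec E w Bool.≟ false ×-dec
    ∃?-Vector (λ x → inSpan h x Bool.≟ true ×-dec Δ w x Bool.≟ true)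

  semidoubling : ∃ NontrivialShift → IsSemidoubling E h
  semidoubling (w , w∉ , Ew , x₀ , x₀∈ , Δx₀) =
    w , ≢0v⇒¬isZero w w≢0 , cong (_∧ _) w∉ , Ew ,
    dim , kernel-codim₁ h (Δ w) Δw-additive h-independent x₀∈ Δx₀ B , f , independent ,
    ⊆F-intro {f = f} {h = h} (λ {x} x∈ → kernel-inSpan h (Δ w) (trans (sym (spans x)) x∈)) ,
    λ y → mk⇔ (to y) from
    where
    w≢0 : w ≢ 0v
    w≢0 refl = Bool.not-¬ w∉ (0v∈span h)
    Δw-additive : ∀ {a b} → inSpan h a ≡ true → inSpan h b ≡ true → Δ w (a ⊕ b) ≡ Δ w a xor Δ w b
    Δw-additive {a} {b} a∈ b∈ = trans (Δ-affine h w∉ a∈ b∈)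
      (trans (cong (λ z → Δ w a xor Δ w b xor z) Ew) (cong (Δ w a xor_) (Bool.xor-identityʳ (Δ w b))))
    B : Basis (kernel h (Δ w))
    B = subspace-basis (additive-kernel-isSubspace h (Δ w) Δw-additive)
    open Basis B renaming (basis to f)
    coset-term : ∀ x → (E x ∧ inFlat h x) xor (inFlat h x ∧ not (inFlat f x)) ≡ inSpan h x ∧ E (w ⊕ x)
    coset-term x with x ≟v 0v
    ... | yes refl rewrite inFlat-0v h | matroid | 0v∈span h | ⊕-identityʳ w | Ew = refl
    ... | no x≢0 rewrite ≢0v⇒inFlat≡inSpan h x≢0 | ≢0v⇒inFlat≡inSpan f x≢0 | spans x =
      shape (inSpan h x) (E x) (E (w ⊕ x))
      where
      shape : ∀ s e e′ → (e ∧ s) xor (s ∧ not (s ∧ not (e′ xor e))) ≡ s ∧ e′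
      shape false false _ = refl
      shape false true _ = refl
      shape true false false = refl
      shape true false true = refl
      shape true true false = refl
      shape true true true = refl
    Doubled : Vector (suc m) → Set
    Doubled y = (E y ∧ inFlat h y) ≡ true ⊎
      ∃ λ x → ((E x ∧ inFlat h x) xor (inFlat h x ∧ not (inFlat f x))) ≡ true × y ≡ w ⊕ x
    to : ∀ y → E y ≡ true → Doubled y
    to y Ey with inSpan h y Bool.≟ true
    ... | yes y∈ = inj₁ (trans (E∧inFlat≡inSpan∧E {E = E} matroid h y) (cong₂ _∧_ y∈ Ey))
    ... | no y∉ = inj₂ (w ⊕ y , trans (coset-term (w ⊕ y))
            (cong₂ _∧_ (hyperplane-complement h-independent w∉ (Bool.¬-not y∉))
                       (trans (cong E (⊕-cancelˡ w y)) Ey)) ,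
          sym (⊕-cancelˡ w y))
    from : ∀ {y} → Doubled y → E y ≡ true
    from {y} (inj₁ Ey∈) =
      Bool.∧-conicalʳ (inSpan h y) _ (trans (sym (E∧inFlat≡inSpan∧E {E = E} matroid h y)) Ey∈)
    from (inj₂ (x , term , refl)) = Bool.∧-conicalʳ (inSpan h x) _ (trans (sym (coset-term x)) term)

  bose-burton : KernelClosed h E → RestrIsBoseBurton E h
  bose-burton closed =
    dim , LinIndep⇒≤ h independent f⊆h , f , independent , ⊆F-intro {f = f} {h = h} f⊆h , restriction
    where
    open Basis (subspace-basis (kernel-isSubspace h E matroid closed)) renaming (basis to f)
    f⊆h : ∀ {x} → inSpan f x ≡ true → inSpan h x ≡ true
    f⊆h {x} x∈ = kernel-inSpan h E (trans (sym (spans x)) x∈)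
    restriction : ∀ x → (E x ∧ inFlat h x) ≡ (inFlat h x ∧ not (inFlat f x))
    restriction x with x ≟v 0v
    ... | yes refl rewrite inFlat-0v h = Bool.∧-zeroʳ (E 0v)
    ... | no x≢0 rewrite ≢0v⇒inFlat≡inSpan h x≢0 | ≢0v⇒inFlat≡inSpan f x≢0 | spans x =
      shape (inSpan h x) (E x)
      where
      shape : ∀ s e → e ∧ s ≡ s ∧ not (s ∧ not e)
      shape false false = refl
      shape false true = refl
      shape true false = refl
      shape true true = refl

  complement-closed : ¬ ∃ NontrivialShift → KernelClosed h E
  complement-closed no-shift {r} {s} r∈ s∈ Er Es
    with ∃?-Vector (λ w → inSpan h w Bool.≟ false ×-dec E w Bool.≟ false)
  ... | yes (w , w∉ , Ew) = begin
    E (r ⊕ s)          ≡⟨ xor≡false⇒≡ (trivial-shifts w∉ Ew (⊕∈span h r∈ s∈)) ⟨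
    E (w ⊕ (r ⊕ s))    ≡⟨ cong E (⊕-assoc w r s) ⟨
    E ((w ⊕ r) ⊕ s)    ≡⟨ xor≡false⇒≡ (trivial-shifts (⊕∉span h w∉ r∈) Ew⊕r s∈) ⟩
    E s                ≡⟨ Es ⟩
    false              ∎
    where
    open ≡-Reasoning
    trivial-shifts : ∀ {w x} → inSpan h w ≡ false → E w ≡ false → inSpan h x ≡ true → Δ w x ≡ false
    trivial-shifts w∉ Ew x∈ = Bool.¬-not λ Δx → no-shift (_ , w∉ , Ew , _ , x∈ , Δx)
    Ew⊕r : E (w ⊕ r) ≡ false
    Ew⊕r = trans (xor≡false⇒≡ (trivial-shifts w∉ Ew r∈)) Er
  ... | no none = Bool.not-injective (begin
    not (E (r ⊕ s))              ≡⟨ cong (_xor E (r ⊕ s)) (outside-in-E (⊕∉span h u∉ r⊕s∈)) ⟨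
    Δ u (r ⊕ s)                  ≡⟨ Δ-affine h u∉ r∈ s∈ ⟩
    Δ u r xor Δ u s xor E u      ≡⟨ cong₂ (λ p q → p xor q xor E u) (Δu r∈ Er) (Δu s∈ Es) ⟩
    true xor true xor E u        ≡⟨ cong (λ z → true xor true xor z) (outside-in-E u∉) ⟩
    true                         ∎)
    where
    open ≡-Reasoning
    outside-in-E : ∀ {v} → inSpan h v ≡ false → E v ≡ true
    outside-in-E {v} v∉ = Bool.¬-not λ Ev → none (v , v∉ , Ev)
    u : Vector (suc m)
    u = proj₁ (∃∉span (n<1+n m) h)
    u∉ : inSpan h u ≡ false
    u∉ = proj₂ (∃∉span (n<1+n m) h)
    r⊕s∈ : inSpan h (r ⊕ s) ≡ true
    r⊕s∈ = ⊕∈span h r∈ s∈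
    Δu : ∀ {x} → inSpan h x ≡ true → E x ≡ false → Δ u x ≡ true
    Δu x∈ Ex = cong₂ _xor_ (outside-in-E (⊕∉span h u∉ x∈)) Ex

open OverHyperplane

lemma4p1 : (m : ℕ) (E : Vector (suc m) → Bool) → IsMatroid E → InE3 E →
    (h : Vec (Vector (suc m)) m) → LinIndep h →
    ¬ RestrIsBoseBurton E h → IsSemidoubling E h
lemma4p1 m E matroid e3 h h-independent not-bose-burton with nontrivialShift? matroid e3 h-independent
... | yes shift = semidoubling matroid e3 h-independent shift
... | no no-shift = contradiction
  (bose-burton matroid e3 h-independent (complement-closed matroid e3 h-independent no-shift)) not-bose-burton
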